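{- Let $G$ be a graph with a unique maximum open packing $U(G)$, and let $x\in U(G)$ be such that $N(x)\cap U(G)\neq\emptyset$. Suppose moreover that $G$ has exactly one open packing of cardinality $\rho^{\rm o}(G)-1$ that does not contain $x$. If $G'$ is obtained from $G$ by appending two new paths $P_3$ to $x$ (i.e., adding two new disjoint paths on 3 vertices each and joining $x$ to one end vertex of each), then $G'$ has a unique maximum open packing.
   Context: An open packing in a graph is a set of vertices whose open neighborhoods are pairwise disjoint; $\rho^{\rm o}(G)$ is the maximum cardinality of an open packing of $G$. -}

module Defs where

open import Data.Nat using (ℕ; _+_; _≤_; _∸_)
open import Data.Fin using (Fin; zero; suc; splitAt; _≟_)
open import Data.Fin.Subset using (Subset; _∈_; _∉_; ∣_∣)
open import Data.Bool using (Bool; true; false)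
open import Data.Sum using (_⊎_; inj₁; inj₂)
open import Data.Product using (Σ; _×_; _,_; ∃)
open import Relation.Nullary using (¬_; yes; no)
open import Relation.Binary.PropositionalEquality using (_≡_; _≢_)

record Graph (n : ℕ) : Set where
  field
    adj    : Fin n → Fin n → Bool
    sym    : ∀ u v → adj u v ≡ adj v u
    irrefl : ∀ v → adj v v ≡ false

open Graph public

Adj : ∀ {n} → (Fin n → Fin n → Bool) → Fin n → Fin n → Set
Adj a u v = a u v ≡ true

IsOpenPacking : ∀ {n} → (Fin n → Fin n → Bool) → Subset n → Set
IsOpenPacking {n} a S =
  ∀ (u v : Fin n) → u ∈ S → v ∈ S → u ≢ v →
    ∀ (w : Fin n) → ¬ (Adj a u w × Adj a v w)

IsMaxOpenPacking : ∀ {n} → (Fin n → Fin n → Bool) → Subset n → Set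
IsMaxOpenPacking {n} a S =
  IsOpenPacking a S × (∀ (T : Subset n) → IsOpenPacking a T → ∣ T ∣ ≤ ∣ S ∣)

IsUniqueMaxOpenPacking : ∀ {n} → (Fin n → Fin n → Bool) → Subset n → Set
IsUniqueMaxOpenPacking {n} a U =
  IsMaxOpenPacking a U × (∀ (T : Subset n) → IsMaxOpenPacking a T → T ≡ U)

HasUniqueMaxOpenPacking : ∀ {n} → (Fin n → Fin n → Bool) → Set
HasUniqueMaxOpenPacking {n} a = Σ (Subset n) (IsUniqueMaxOpenPacking a)

-- Adjacency among the six new vertices: two paths 0-1-2 and 3-4-5.
newAdj : Fin 6 → Fin 6 → Bool
newAdj zero (suc zero) = true
newAdj (suc zero) zero = true
newAdj (suc zero) (suc (suc zero)) = true
newAdj (suc (suc zero)) (suc zero) = true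
newAdj (suc (suc (suc zero))) (suc (suc (suc (suc zero)))) = true
newAdj (suc (suc (suc (suc zero)))) (suc (suc (suc zero))) = true
newAdj (suc (suc (suc (suc zero)))) (suc (suc (suc (suc (suc zero))))) = true
newAdj (suc (suc (suc (suc (suc zero))))) (suc (suc (suc (suc zero)))) = true
newAdj _ _ = false

isAttach : Fin 6 → Bool
isAttach zero = true
isAttach (suc (suc (suc zero))) = true
isAttach _ = false

eqb : ∀ {n} → Fin n → Fin n → Bool
eqb u v with u ≟ v
... | yes _ = true
... | no _ = false

-- G' : G with two new P₃'s appended at x; old vertices are the first n of Fin (n + 6)
appendTwoP3 : ∀ {n} → Graph n → Fin n → Fin (n + 6) → Fin (n + 6) → Bool
appendTwoP3 {n} G x u v with splitAt n u | splitAt n v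
... | inj₁ u' | inj₁ v' = adj G u' v'
... | inj₁ u' | inj₂ j  = Data.Bool._∧_ (eqb u' x) (isAttach j)
... | inj₂ i  | inj₁ v' = Data.Bool._∧_ (eqb v' x) (isAttach i)
... | inj₂ i  | inj₂ j  = newAdj i j

module Submission where

-- Let ρ = ∣U∣.  Removing x from U gives an open packing of size ρ - 1 avoiding x, so
-- by uniqueness S = U - x, and the neighbour y of x in U lies in S.  Call the appended
-- paths 0 – 1 – 2 and 3 – 4 – 5 (x is joined to 0 and 3) and let W = {1, 2, 4, 5}.
-- We show that M = S ∪ W is the unique maximum open packing of G'.
--   * M is an open packing: x ∉ S is the only old vertex with new neighbours, the
--     members of W have no old neighbours, and W is an open packing of 2P₃.
--   * Let T ∪ Y be an open packing of G' (T old, Y new).  Then T is an open packing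
--     of G and the two ends of each path are not both in Y, so Y has at most two
--     vertices on each path.  If x ∈ T, the middle vertices 1 and 4 (which share a
--     neighbour with x) are excluded, so ∣T ∪ Y∣ ≤ ρ + 2.  If x ∉ T then T ≠ U, so
--     ∣T∣ ≤ ρ - 1 and ∣T ∪ Y∣ ≤ ρ + 3; equality forces T = S, hence y ∈ T, which
--     excludes the attachment vertices 0 and 3 (they share x with y), so Y = W.

open import Defs hiding (sym)
open import Function using (_∘_)
open import Data.Nat using (ℕ; zero; suc; _+_; _∸_; _≤_; _<_; s≤s; z≤n; s≤s⁻¹)
open import Data.Nat.Properties
  using (≤-antisym; ≤-trans; ≤-reflexive; ≤∧≢⇒<; +-mono-≤; +-monoˡ-≤; +-monoʳ-≤;
         +-cancelˡ-≤; +-cancelʳ-≤; +-suc; <⇒≤; <⇒≱; module ≤-Reasoning)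
open import Data.Fin using (Fin; zero; suc; _↑ˡ_; _↑ʳ_; splitAt; join; _≟_)
open import Data.Fin.Properties
  using (all?; suc-injective; ↑ˡ-injective; ↑ʳ-injective; splitAt-↑ˡ; splitAt-↑ʳ; join-splitAt)
open import Data.Fin.Subset using (Subset; inside; outside; _∈_; _∉_; _⊆_; ∣_∣; _-_; ⁅_⁆)
open import Data.Fin.Subset.Properties
  using (_∈?_; ∣p∣≤n; p─⊥≡p; p─q⊆p; x∈p∧x≢y⇒x∈p-y)
open import Data.Vec using ([]; _∷_; _++_; here; there)
import Data.Vec as Vec
open import Data.Bool using (Bool; true; _∧_)
import Data.Bool.Properties as Bool
open import Data.Sum using (inj₁; inj₂; _⊎_)
open import Data.Empty using (⊥; ⊥-elim)
open import Data.Product using (Σ; _×_; _,_; proj₁; proj₂)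
open import Relation.Nullary using (Dec; yes; no; ¬?)
open import Relation.Nullary.Decidable using (_×-dec_; _→-dec_; from-yes)
open import Relation.Binary.PropositionalEquality
  using (_≡_; _≢_; refl; sym; trans; cong; cong₂; subst)

∣++∣ : ∀ {m k} (p : Subset m) (q : Subset k) → ∣ p ++ q ∣ ≡ ∣ p ∣ + ∣ q ∣
∣++∣ []            q = refl
∣++∣ (inside ∷ p)  q = cong suc (∣++∣ p q)
∣++∣ (outside ∷ p) q = ∣++∣ p q

∈-++⁺ˡ : ∀ {m k} {p : Subset m} (q : Subset k) {i} → i ∈ p → (i ↑ˡ k) ∈ p ++ q
∈-++⁺ˡ q here        = here
∈-++⁺ˡ q (there i∈p) = there (∈-++⁺ˡ q i∈p)

∈-++⁺ʳ : ∀ {m k} (p : Subset m) {q : Subset k} {j} → j ∈ q → (m ↑ʳ j) ∈ p ++ q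
∈-++⁺ʳ []      j∈q = j∈q
∈-++⁺ʳ (_ ∷ p) j∈q = there (∈-++⁺ʳ p j∈q)

∈-++⁻ˡ : ∀ {m k} (p : Subset m) (q : Subset k) {i} → (i ↑ˡ k) ∈ p ++ q → i ∈ p
∈-++⁻ˡ (_ ∷ p) q {zero}  here      = here
∈-++⁻ˡ (_ ∷ p) q {suc i} (there m) = there (∈-++⁻ˡ p q m)

∈-++⁻ʳ : ∀ {m k} (p : Subset m) {q : Subset k} {j} → (m ↑ʳ j) ∈ p ++ q → j ∈ q
∈-++⁻ʳ []      j∈q       = j∈q
∈-++⁻ʳ (_ ∷ p) (there m) = ∈-++⁻ʳ p m

∣p-x∣ : ∀ {m} (p : Subset m) {x} → x ∈ p → suc ∣ p - x ∣ ≡ ∣ p ∣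
∣p-x∣ (inside ∷ p)  here        = cong (suc ∘ ∣_∣) (p─⊥≡p p)
∣p-x∣ (inside ∷ p)  (there x∈p) = cong suc (∣p-x∣ p x∈p)
∣p-x∣ (outside ∷ p) (there x∈p) = ∣p-x∣ p x∈p

x∉p-x : ∀ {m} (p : Subset m) (x : Fin m) → x ∉ p - x
x∉p-x (_ ∷ p) zero    ()
x∉p-x (_ ∷ p) (suc x) (there x∈p-x) = x∉p-x p x x∈p-x

+-tight : ∀ {a b m k} → a ≤ m → b ≤ k → m + k ≤ a + b → a ≡ m × b ≡ k
+-tight {a} {b} {m} {k} a≤m b≤k m+k≤a+b =
  ≤-antisym a≤m (+-cancelʳ-≤ k m a (≤-trans m+k≤a+b (+-monoʳ-≤ a b≤k))) ,
  ≤-antisym b≤k (+-cancelˡ-≤ m k b (≤-trans m+k≤a+b (+-monoˡ-≤ b a≤m)))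

-- The arithmetic comparison of the two cases: ρ + 2 < ρ + 3 with ρ = k + 1.
1+k+2<k+4 : ∀ k → suc k + 2 < k + 4
1+k+2<k+4 k = ≤-reflexive (sym (trans (+-suc k 3) (cong suc (+-suc k 2))))

∧-true : ∀ {a b} → a ∧ b ≡ true → a ≡ true × b ≡ true
∧-true {true} refl = refl , refl

eqb-refl : ∀ {m} (u : Fin m) → eqb u u ≡ true
eqb-refl u with u ≟ u
... | yes _  = refl
... | no u≢u = ⊥-elim (u≢u refl)

eqb-sound : ∀ {m} (u v : Fin m) → eqb u v ≡ true → u ≡ v
eqb-sound u v h with u ≟ v
... | yes u≡v = u≡v

module _ {m : ℕ} (a : Fin m → Fin m → Bool) where

  -- All quantifiers in the definition range over finite sets, so it is decidable.
  isOpenPacking? : (S : Subset m) → Dec (IsOpenPacking a S)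
  isOpenPacking? S =
    all? λ u → all? λ v → (u ∈? S) →-dec (v ∈? S) →-dec ¬? (u ≟ v) →-dec
    all? λ w → ¬? ((a u w Bool.≟ true) ×-dec (a v w Bool.≟ true))

  packing-⊆ : ∀ {S T} → S ⊆ T → IsOpenPacking a T → IsOpenPacking a S
  packing-⊆ S⊆T P u v u∈S v∈S = P u v (S⊆T u∈S) (S⊆T v∈S)

  avoiding-smaller : ∀ {U T x} → IsUniqueMaxOpenPacking a U → x ∈ U →
    IsOpenPacking a T → x ∉ T → ∣ T ∣ < ∣ U ∣
  avoiding-smaller {U} {T} {x} ((_ , U-max) , U-unique) x∈U T-packing x∉T =
    ≤∧≢⇒< (U-max T T-packing) λ ∣T∣≡∣U∣ →
      let T-max : ∀ T′ → IsOpenPacking a T′ → ∣ T′ ∣ ≤ ∣ T ∣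
          T-max T′ P′ = subst (∣ T′ ∣ ≤_) (sym ∣T∣≡∣U∣) (U-max T′ P′)
      in x∉T (subst (x ∈_) (sym (U-unique T (T-packing , T-max))) x∈U)

  unique-max-by-bound : ∀ {M k} → IsOpenPacking a M → ∣ M ∣ ≡ k →
    (∀ T → IsOpenPacking a T → ∣ T ∣ ≤ k × (k ≤ ∣ T ∣ → T ≡ M)) →
    IsUniqueMaxOpenPacking a M
  unique-max-by-bound M-packing ∣M∣≡k bound =
    (M-packing , λ T P → subst (∣ T ∣ ≤_) (sym ∣M∣≡k) (proj₁ (bound T P))) ,
    λ T (P , T-max) → proj₂ (bound T P) (subst (_≤ ∣ T ∣) ∣M∣≡k (T-max _ M-packing))

-- Subsets of a path 0 – 1 – 2.  The ends share the neighbour 1, so an open packing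
-- never contains both of them.

EndsApart : Subset 3 → Set
EndsApart p = zero ∈ p → suc (suc zero) ∈ p → ⊥

p3-≤2 : ∀ p → EndsApart p → ∣ p ∣ ≤ 2
p3-≤2 (inside ∷ _ ∷ inside ∷ [])  apart = ⊥-elim (apart here (there (there here)))
p3-≤2 (inside ∷ b ∷ outside ∷ []) _     = s≤s (∣p∣≤n (b ∷ []))
p3-≤2 (outside ∷ q)               _     = ∣p∣≤n q

p3-≤1 : ∀ p → EndsApart p → suc zero ∉ p → ∣ p ∣ ≤ 1
p3-≤1 (inside ∷ _ ∷ inside ∷ [])        apart _      = ⊥-elim (apart here (there (there here)))
p3-≤1 (_ ∷ inside ∷ _ ∷ [])             _     no-mid = ⊥-elim (no-mid (there here))
p3-≤1 (inside ∷ outside ∷ outside ∷ []) _     _      = s≤s z≤n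
p3-≤1 (outside ∷ outside ∷ c ∷ [])      _     _      = ∣p∣≤n (c ∷ [])

p3-far : Subset 3
p3-far = outside ∷ inside ∷ inside ∷ []

p3-≡2 : ∀ p → zero ∉ p → ∣ p ∣ ≡ 2 → p ≡ p3-far
p3-≡2 (inside ∷ _)                       no-end _  = ⊥-elim (no-end here)
p3-≡2 (outside ∷ inside ∷ inside ∷ [])   _      _  = refl
p3-≡2 (outside ∷ inside ∷ outside ∷ [])  _      ()
p3-≡2 (outside ∷ outside ∷ inside ∷ [])  _      ()
p3-≡2 (outside ∷ outside ∷ outside ∷ []) _      ()

pathTails : Subset 6
pathTails = p3-far ++ p3-far

pathTails-packing : IsOpenPacking newAdj pathTails
pathTails-packing = from-yes (isOpenPacking? newAdj pathTails)

attach∉pathTails : ∀ {j} → isAttach j ≡ true → j ∉ pathTails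
attach∉pathTails {zero}                   _  ()
attach∉pathTails {suc (suc (suc zero))}   _  (there (there (there ())))
attach∉pathTails {suc zero}               ()
attach∉pathTails {suc (suc zero)}         ()
attach∉pathTails {suc (suc (suc (suc _)))} ()

old≢new : ∀ {m k} (i : Fin m) (j : Fin k) → i ↑ˡ k ≢ m ↑ʳ j
old≢new zero    j ()
old≢new (suc i) j eq = old≢new i j (suc-injective eq)

module AppendedGraph {n : ℕ} (G : Graph n) (x : Fin n) where

  G′ : Fin (n + 6) → Fin (n + 6) → Bool
  G′ = appendTwoP3 G x

  old : Fin n → Fin (n + 6)
  old i = i ↑ˡ 6

  new : Fin 6 → Fin (n + 6)
  new j = n ↑ʳ j

  data Vertex : Fin (n + 6) → Set where
    isOld : ∀ i → Vertex (old i)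
    isNew : ∀ j → Vertex (new j)

  vertex : ∀ u → Vertex u
  vertex u = subst Vertex (join-splitAt n 6 u) (fromSplit (splitAt n u))
    where
    fromSplit : (s : Fin n ⊎ Fin 6) → Vertex (join n 6 s)
    fromSplit (inj₁ i) = isOld i
    fromSplit (inj₂ j) = isNew j

  adj-old-old : ∀ i k → G′ (old i) (old k) ≡ adj G i k
  adj-old-old i k rewrite splitAt-↑ˡ n i 6 | splitAt-↑ˡ n k 6 = refl

  adj-old-new : ∀ i j → G′ (old i) (new j) ≡ eqb i x ∧ isAttach j
  adj-old-new i j rewrite splitAt-↑ˡ n i 6 | splitAt-↑ʳ n 6 j = refl

  adj-new-old : ∀ j k → G′ (new j) (old k) ≡ eqb k x ∧ isAttach j
  adj-new-old j k rewrite splitAt-↑ʳ n 6 j | splitAt-↑ˡ n k 6 = refl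

  adj-new-new : ∀ i j → G′ (new i) (new j) ≡ newAdj i j
  adj-new-new i j rewrite splitAt-↑ʳ n 6 i | splitAt-↑ʳ n 6 j = refl

  old~new⇒x : ∀ {i j} → Adj G′ (old i) (new j) → i ≡ x
  old~new⇒x {i} {j} h = eqb-sound i x (proj₁ (∧-true (trans (sym (adj-old-new i j)) h)))

  new~old⇒attach : ∀ {j k} → Adj G′ (new j) (old k) → isAttach j ≡ true
  new~old⇒attach {j} {k} h = proj₂ (∧-true {eqb k x} (trans (sym (adj-new-old j k)) h))

  x~attach : ∀ {j} → isAttach j ≡ true → Adj G′ (old x) (new j)
  x~attach {j} att = trans (adj-old-new x j) (cong₂ _∧_ (eqb-refl x) att)

  attach~x : ∀ {j} → isAttach j ≡ true → Adj G′ (new j) (old x)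
  attach~x {j} att = trans (adj-new-old j x) (cong₂ _∧_ (eqb-refl x) att)

  restrict : ∀ {T Y} → IsOpenPacking G′ (T ++ Y) → IsOpenPacking (adj G) T
  restrict {T} {Y} P i j i∈T j∈T i≢j k (i~k , j~k) =
    P (old i) (old j) (∈-++⁺ˡ Y i∈T) (∈-++⁺ˡ Y j∈T) (i≢j ∘ ↑ˡ-injective 6 i j) (old k)
      (trans (adj-old-old i k) i~k , trans (adj-old-old j k) j~k)

  new-clash : ∀ {T Y i j} l → IsOpenPacking G′ (T ++ Y) → i ∈ Y → j ∈ Y → i ≢ j →
    newAdj i l ≡ true → newAdj j l ≡ true → ⊥
  new-clash {T} {i = i} {j} l P i∈Y j∈Y i≢j i~l j~l =
    P (new i) (new j) (∈-++⁺ʳ T i∈Y) (∈-++⁺ʳ T j∈Y) (i≢j ∘ ↑ʳ-injective n i j) (new l)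
      (trans (adj-new-new i l) i~l , trans (adj-new-new j l) j~l)

  old-new-clash : ∀ {T Y i j} w → IsOpenPacking G′ (T ++ Y) → i ∈ T → j ∈ Y →
    Adj G′ (old i) w → Adj G′ (new j) w → ⊥
  old-new-clash {T} {Y} {i} {j} w P i∈T j∈Y i~w j~w =
    P (old i) (new j) (∈-++⁺ˡ Y i∈T) (∈-++⁺ʳ T j∈Y) (old≢new i j) w (i~w , j~w)

  member~old : ∀ {S u l} → u ∈ S ++ pathTails → Adj G′ u (old l) →
    Σ (Fin n) λ i → u ≡ old i × i ∈ S × Adj (adj G) i l
  member~old {S} {u} {l} u∈ u~l with vertex u
  ... | isOld i = i , refl , ∈-++⁻ˡ S pathTails u∈ , trans (sym (adj-old-old i l)) u~l
  ... | isNew j = ⊥-elim (attach∉pathTails (new~old⇒attach u~l) (∈-++⁻ʳ S u∈))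

  member~new : ∀ {S u l} → x ∉ S → u ∈ S ++ pathTails → Adj G′ u (new l) →
    Σ (Fin 6) λ j → u ≡ new j × j ∈ pathTails × newAdj j l ≡ true
  member~new {S} {u} {l} x∉S u∈ u~l with vertex u
  ... | isOld i = ⊥-elim (x∉S (subst (_∈ S) (old~new⇒x u~l) (∈-++⁻ˡ S pathTails u∈)))
  ... | isNew j = j , refl , ∈-++⁻ʳ S u∈ , trans (sym (adj-new-new j l)) u~l

  extend-packing : ∀ {S} → IsOpenPacking (adj G) S → x ∉ S → IsOpenPacking G′ (S ++ pathTails)
  extend-packing P x∉S u v u∈ v∈ u≢v w (u~w , v~w) with vertex w
  ... | isOld l with member~old u∈ u~w | member~old v∈ v~w
  ...   | i , refl , i∈S , i~l | j , refl , j∈S , j~l =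
          P i j i∈S j∈S (u≢v ∘ cong old) l (i~l , j~l)
  extend-packing P x∉S u v u∈ v∈ u≢v w (u~w , v~w) | isNew l
      with member~new x∉S u∈ u~w | member~new x∉S v∈ v~w
  ...   | i , refl , i∈W , i~l | j , refl , j∈W , j~l =
          pathTails-packing i j i∈W j∈W (u≢v ∘ cong new) l (i~l , j~l)

module Uniqueness {n : ℕ} (G : Graph n) (U : Subset n) (x : Fin n)
  (U-unique : IsUniqueMaxOpenPacking (adj G) U) (x∈U : x ∈ U)
  (y : Fin n) (y∈U : y ∈ U) (x~y : Adj (adj G) x y)
  (S : Subset n) (S-packing : IsOpenPacking (adj G) S) (∣S∣≡∣U∣∸1 : ∣ S ∣ ≡ ∣ U ∣ ∸ 1) (x∉S : x ∉ S)
  (S-unique : ∀ T → IsOpenPacking (adj G) T → ∣ T ∣ ≡ ∣ U ∣ ∸ 1 → x ∉ T → T ≡ S) where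

  open AppendedGraph G x

  -- U - x is an open packing of size ρ - 1 avoiding x, so it is S.
  S≡U-x : S ≡ U - x
  S≡U-x = sym (S-unique (U - x)
    (packing-⊆ (adj G) (p─q⊆p U ⁅ x ⁆) (proj₁ (proj₁ U-unique)))
    (cong (_∸ 1) (∣p-x∣ U x∈U)) (x∉p-x U x))

  ∣U∣≡1+∣S∣ : ∣ U ∣ ≡ suc ∣ S ∣
  ∣U∣≡1+∣S∣ = trans (sym (∣p-x∣ U x∈U)) (cong (suc ∘ ∣_∣) (sym S≡U-x))

  -- G has no loops, so the neighbour y differs from x.
  y≢x : y ≢ x
  y≢x y≡x with trans (sym (subst (Adj (adj G) x) y≡x x~y)) (irrefl G x)
  ... | ()

  y∈S : y ∈ S
  y∈S = subst (y ∈_) (sym S≡U-x) (x∈p∧x≢y⇒x∈p-y y∈U y≢x)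

  M : Subset (n + 6)
  M = S ++ pathTails

  Bounded : Subset (n + 6) → Set
  Bounded T′ = ∣ T′ ∣ ≤ ∣ S ∣ + 4 × (∣ S ∣ + 4 ≤ ∣ T′ ∣ → T′ ≡ M)

  strict⇒Bounded : ∀ {T′} → ∣ T′ ∣ < ∣ S ∣ + 4 → Bounded T′
  strict⇒Bounded lt = <⇒≤ lt , λ ge → ⊥-elim (<⇒≱ lt ge)

  module Split (T : Subset n) (p q : Subset 3) (P : IsOpenPacking G′ (T ++ (p ++ q))) where

    ∣T′∣ : ∣ T ++ (p ++ q) ∣ ≡ ∣ T ∣ + (∣ p ∣ + ∣ q ∣)
    ∣T′∣ = trans (∣++∣ T (p ++ q)) (cong (∣ T ∣ +_) (∣++∣ p q))

    p-apart : EndsApart p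
    p-apart e₀ e₂ = new-clash {T = T} (suc zero) P (∈-++⁺ˡ q e₀) (∈-++⁺ˡ q e₂) (λ ()) refl refl

    q-apart : EndsApart q
    q-apart e₃ e₅ = new-clash {T = T} (suc (suc (suc (suc zero)))) P (∈-++⁺ʳ p e₃) (∈-++⁺ʳ p e₅) (λ ()) refl refl

    -- x and a middle vertex share the attachment vertex of its path.
    middles-excluded : x ∈ T → suc zero ∉ p × suc zero ∉ q
    middles-excluded x∈T =
      (λ m₁ → old-new-clash (new zero) P x∈T (∈-++⁺ˡ q m₁) (x~attach refl) (adj-new-new _ _)) ,
      (λ m₂ → old-new-clash (new (suc (suc (suc zero)))) P x∈T (∈-++⁺ʳ p m₂) (x~attach refl) (adj-new-new _ _))

    -- y and an attachment vertex share the neighbour x.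
    attachments-excluded : y ∈ T → zero ∉ p × zero ∉ q
    attachments-excluded y∈T =
      (λ a₁ → old-new-clash (old x) P y∈T (∈-++⁺ˡ q a₁) y~x (attach~x refl)) ,
      (λ a₂ → old-new-clash (old x) P y∈T (∈-++⁺ʳ p a₂) y~x (attach~x refl))
      where
      y~x : Adj G′ (old y) (old x)
      y~x = trans (adj-old-old y x) (trans (Graph.sym G y x) x~y)

    bounded-with-x : x ∈ T → Bounded (T ++ (p ++ q))
    bounded-with-x x∈T = strict⇒Bounded (begin-strict
      ∣ T ++ (p ++ q) ∣       ≡⟨ ∣T′∣ ⟩
      ∣ T ∣ + (∣ p ∣ + ∣ q ∣) ≤⟨ +-mono-≤ ∣T∣≤1+∣S∣ (+-mono-≤ ∣p∣≤1 ∣q∣≤1) ⟩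
      suc ∣ S ∣ + 2           <⟨ 1+k+2<k+4 ∣ S ∣ ⟩
      ∣ S ∣ + 4               ∎)
      where
      open ≤-Reasoning
      ∣T∣≤1+∣S∣ : ∣ T ∣ ≤ suc ∣ S ∣
      ∣T∣≤1+∣S∣ = subst (∣ T ∣ ≤_) ∣U∣≡1+∣S∣ (proj₂ (proj₁ U-unique) T (restrict P))
      ∣p∣≤1 : ∣ p ∣ ≤ 1
      ∣p∣≤1 = p3-≤1 p p-apart (proj₁ (middles-excluded x∈T))
      ∣q∣≤1 : ∣ q ∣ ≤ 1
      ∣q∣≤1 = p3-≤1 q q-apart (proj₂ (middles-excluded x∈T))

    bounded-without-x : x ∉ T → Bounded (T ++ (p ++ q))
    bounded-without-x x∉T = subst (_≤ ∣ S ∣ + 4) (sym ∣T′∣) (+-mono-≤ ∣T∣≤∣S∣ ∣Y∣≤4) , tight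
      where
      ∣T∣≤∣S∣ : ∣ T ∣ ≤ ∣ S ∣
      ∣T∣≤∣S∣ = s≤s⁻¹ (subst (∣ T ∣ <_) ∣U∣≡1+∣S∣
        (avoiding-smaller (adj G) U-unique x∈U (restrict P) x∉T))
      ∣Y∣≤4 : ∣ p ∣ + ∣ q ∣ ≤ 2 + 2
      ∣Y∣≤4 = +-mono-≤ (p3-≤2 p p-apart) (p3-≤2 q q-apart)
      -- Equality forces T = S (so y ∈ T) and two vertices on each path.
      tight : ∣ S ∣ + 4 ≤ ∣ T ++ (p ++ q) ∣ → T ++ (p ++ q) ≡ M
      tight ge = cong₂ _++_ T≡S (cong₂ _++_ (p3-≡2 p no-attach₁ ∣p∣≡2) (p3-≡2 q no-attach₂ ∣q∣≡2))
        where
        sizes = +-tight ∣T∣≤∣S∣ ∣Y∣≤4 (subst (∣ S ∣ + 4 ≤_) ∣T′∣ ge)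
        T≡S : T ≡ S
        T≡S = S-unique T (restrict P) (trans (proj₁ sizes) ∣S∣≡∣U∣∸1) x∉T
        path-sizes = +-tight (p3-≤2 p p-apart) (p3-≤2 q q-apart) (≤-reflexive (sym (proj₂ sizes)))
        ∣p∣≡2 : ∣ p ∣ ≡ 2
        ∣p∣≡2 = proj₁ path-sizes
        ∣q∣≡2 : ∣ q ∣ ≡ 2
        ∣q∣≡2 = proj₂ path-sizes
        no-attach₁ : zero ∉ p
        no-attach₁ = proj₁ (attachments-excluded (subst (y ∈_) (sym T≡S) y∈S))
        no-attach₂ : zero ∉ q
        no-attach₂ = proj₂ (attachments-excluded (subst (y ∈_) (sym T≡S) y∈S))

  bounded : ∀ T′ → IsOpenPacking G′ T′ → Bounded T′
  bounded T′ P with Vec.splitAt n T′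
  ... | T , Y , refl with Vec.splitAt 3 Y
  ...   | p , q , refl with x ∈? T
  ...     | yes x∈T = Split.bounded-with-x T p q P x∈T
  ...     | no x∉T  = Split.bounded-without-x T p q P x∉T

  result : HasUniqueMaxOpenPacking G′
  result = M , unique-max-by-bound G′ (extend-packing S-packing x∉S) (∣++∣ S pathTails) bounded

mainTheorem16 : (n : ℕ) (G : Graph n) (U : Subset n) (x : Fin n) →
    IsUniqueMaxOpenPacking (adj G) U →
    x ∈ U →
    Σ (Fin n) (λ y → y ∈ U × Adj (adj G) x y) →
    Σ (Subset n) (λ S → (IsOpenPacking (adj G) S × ∣ S ∣ ≡ ∣ U ∣ ∸ 1 × x ∉ S) ×
      (∀ (T : Subset n) → IsOpenPacking (adj G) T → ∣ T ∣ ≡ ∣ U ∣ ∸ 1 → x ∉ T → T ≡ S)) →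
    HasUniqueMaxOpenPacking (appendTwoP3 G x)
mainTheorem16 n G U x U-unique x∈U (y , y∈U , x~y) (S , (S-packing , ∣S∣≡∣U∣∸1 , x∉S) , S-unique) =
  Uniqueness.result G U x U-unique x∈U y y∈U x~y S S-packing ∣S∣≡∣U∣∸1 x∉S S-unique
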